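{- Let $I$ be a finite set of indices and, for each $i\in I$, let $\psi_i,\chi_i$ be $\mathsf{Kh}$-free formulas. Let $\varphi^-=\bigwedge_{i\in I}\neg\mathsf{Kh}(\psi_i,\chi_i)$ and $\theta^-=\bigwedge_{i\in I}\mathsf{E}(\psi_i\land\neg\chi_i)$. Then $\varphi^-$ is satisfiable (in some LTS) if and only if $\theta^-$ is satisfiable (in some $\mathfrak{L}(\mathsf{A})$ model).
   Context: Fix countable sets $\mathsf{Prop}$ of propositional symbols and $\mathsf{Act}$ of action symbols. Formulas of $\mathfrak{L}(\mathsf{Kh})$: $\varphi ::= p \mid \neg\varphi \mid \varphi\lor\varphi \mid \mathsf{Kh}(\varphi,\varphi)$, $p\in\mathsf{Prop}$. An LTS is $\mathfrak{M}=\langle S,(R_a)_{a\in\mathsf{Act}},V\rangle$ with $S\neq\emptyset$, $R_a\subseteq S\times S$, $V:\mathsf{Prop}\to 2^S$. For $\pi\in\mathsf{Act}^*$: $R_\varepsilon=\{(s,s):s\in S\}$, $R_{\pi a}$ is the composition of $R_\pi$ followed by $R_a$, $R_\pi(X)=\{t:\exists s\in X,(s,t)\in R_\pi\}$. A plan $a_1\dots a_n$ is strongly executable at $s$ iff for all $0\le i<n$ and all $t\in R_{a_1\dots a_i}(s)$, $R_{a_{i+1}}(t)\ne\emptyset$; $\mathrm{SE}(\pi)$ is the set of such states. Truth sets are Boolean as usual on $p,\neg,\lor$, and $[\![\mathsf{Kh}(\varphi,\psi)]\!]=S$ if some $\pi\in\mathsf{Act}^*$ satisfies $[\![\varphi]\!]\subseteq\mathrm{SE}(\pi)$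 and $R_\pi([\![\varphi]\!])\subseteq[\![\psi]\!]$, else $\emptyset$. The logic $\mathfrak{L}(\mathsf{A})$ has formulas $p\mid\neg\varphi\mid\varphi\lor\varphi\mid\mathsf{A}\varphi$, with $\mathsf{E}\varphi:=\neg\mathsf{A}\neg\varphi$, interpreted in models $\langle S,V\rangle$ ($S\neq\emptyset$, $V:\mathsf{Prop}\to2^S$) with $[\![\mathsf{A}\varphi]\!]=S$ if $[\![\varphi]\!]=S$ and $\emptyset$ otherwise. A formula is satisfiable in a logic iff some model of that logic has non-empty truth set for it. -}

module Defs where

open import Data.Nat using (ℕ; zero; suc)
open import Data.Bool using (Bool; true)
open import Data.Fin using (Fin)
open import Data.List using (List; []; _∷_)
open import Data.Product using (Σ; ∃; _×_)
open import Data.Sum using (_⊎_)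
open import Data.Unit using (⊤)
open import Relation.Nullary using (¬_)
open import Relation.Binary.PropositionalEquality using (_≡_)

Prop : Set
Prop = ℕ

Act : Set
Act = ℕ

-- Kh-free (purely propositional) formulas
data PForm : Set where
  atom : Prop → PForm
  neg  : PForm → PForm
  disj : PForm → PForm → PForm

data KhForm : Set where
  atom : Prop → KhForm
  neg  : KhForm → KhForm
  disj : KhForm → KhForm → KhForm
  Kh   : KhForm → KhForm → KhForm

data AForm : Set where
  atom : Prop → AForm
  neg  : AForm → AForm
  disj : AForm → AForm → AForm
  A    : AForm → AForm

toKh : PForm → KhForm
toKh (atom p)   = atom p
toKh (neg φ)    = neg (toKh φ)
toKh (disj φ ψ) = disj (toKh φ) (toKh ψ)

toA : PForm → AForm
toA (atom p)   = atom p
toA (neg φ)    = neg (toA φ)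
toA (disj φ ψ) = disj (toA φ) (toA ψ)

conjKh : KhForm → KhForm → KhForm
conjKh φ ψ = neg (disj (neg φ) (neg ψ))

topKh : KhForm
topKh = disj (atom 0) (neg (atom 0))

bigConjKh : List KhForm → KhForm
bigConjKh []       = topKh
bigConjKh (φ ∷ φs) = conjKh φ (bigConjKh φs)

conjA : AForm → AForm → AForm
conjA φ ψ = neg (disj (neg φ) (neg ψ))

topA : AForm
topA = disj (atom 0) (neg (atom 0))

bigConjA : List AForm → AForm
bigConjA []       = topA
bigConjA (φ ∷ φs) = conjA φ (bigConjA φs)

E : AForm → AForm
E φ = neg (A (neg φ))

-- finite index set I = Fin n: list of the family's members
finList : {X : Set} (n : ℕ) → (Fin n → X) → List X
finList zero    f = []
finList (suc n) f = f Fin.zero ∷ finList n (λ i → f (Fin.suc i))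

record LTS : Set₁ where
  field
    S   : Set
    s₀  : S                      -- S ≠ ∅
    R   : Act → S → S → Set
    V   : Prop → S → Bool

module _ (M : LTS) where
  open LTS M

  -- R_π : R_ε = identity, R_{aπ} = R_a followed by R_π
  -- (equivalent to the paper's R_{πa} = R_π followed by R_a)
  Rπ : List Act → S → S → Set
  Rπ []      s t = s ≡ t
  Rπ (a ∷ π) s t = ∃ λ u → R a s u × Rπ π u t

  SE : List Act → S → Set
  SE []      s = ⊤
  SE (a ∷ π) s = (∃ λ t → R a s t) × (∀ t → R a s t → SE π t)

  satKh : KhForm → S → Set
  satKh (atom p)   s = V p s ≡ true
  satKh (neg φ)    s = ¬ satKh φ s
  satKh (disj φ ψ) s = satKh φ s ⊎ satKh ψ s
  satKh (Kh φ ψ)   s = Σ (List Act) λ π →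
                         (∀ t → satKh φ t → SE π t) ×
                         (∀ t u → satKh φ t → Rπ π t u → satKh ψ u)

record AModel : Set₁ where
  field
    S  : Set
    s₀ : S
    V  : Prop → S → Bool

module _ (M : AModel) where
  open AModel M

  satA : AForm → S → Set
  satA (atom p)   s = V p s ≡ true
  satA (neg φ)    s = ¬ satA φ s
  satA (disj φ ψ) s = satA φ s ⊎ satA ψ s
  satA (A φ)      s = ∀ t → satA φ t

SatisfiableKh : KhForm → Set₁
SatisfiableKh φ = Σ LTS λ M → Σ (LTS.S M) λ s → satKh M φ s

SatisfiableA : AForm → Set₁
SatisfiableA φ = Σ AModel λ M → Σ (AModel.S M) λ s → satA M φ s

phiMinus : (n : ℕ) → (Fin n → PForm) → (Fin n → PForm) → KhForm
phiMinus n ψ χ = bigConjKh (finList n (λ i → neg (Kh (toKh (ψ i)) (toKh (χ i)))))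

thetaMinus : (n : ℕ) → (Fin n → PForm) → (Fin n → PForm) → AForm
thetaMinus n ψ χ = bigConjA (finList n (λ i → E (conjA (toA (ψ i)) (neg (toA (χ i))))))

-- Kh-free formulas only look at the valuation of a single state, so both sides
-- reduce to statements about the family of valuations.  ¬Kh(ψ, χ) forces a
-- (ψ ∧ ¬χ)-state, since otherwise the empty plan witnesses Kh(ψ, χ); this gives
-- θ⁻ on the same states.  Conversely, in an LTS without transitions the empty
-- plan is the only candidate (no nonempty plan is strongly executable at a
-- ψ-state, and if there is no ψ-state then E(ψ ∧ ¬χ) fails), so there
-- ¬Kh(ψ, χ) is exactly E(ψ ∧ ¬χ).
module Submission where

open import Defs
open import Data.Nat using (ℕ; zero; suc)
open import Data.Fin using (Fin)
open import Data.Product using (_×_; _,_)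
open import Data.Sum using (_⊎_; inj₁; inj₂; [_,_])
open import Data.Unit using (tt)
open import Data.Empty using (⊥; ⊥-elim)
open import Data.Bool using (Bool; true)
open import Data.Bool.Properties using (_≟_)
open import Data.List using (List; []; _∷_)
open import Function using (_∘_; id; flip)
open import Function.Bundles using (_⇔_; mk⇔; Equivalence)
open import Relation.Nullary using (¬_; Dec)
open import Relation.Nullary.Decidable using (¬?; _⊎-dec_; toSum; decidable-stable)
open import Relation.Binary.PropositionalEquality using (_≡_; refl; cong; cong₂; subst; sym)

_⊨_ : (Prop → Bool) → PForm → Set
v ⊨ atom p   = v p ≡ true
v ⊨ neg φ    = ¬ (v ⊨ φ)
v ⊨ disj φ ψ = (v ⊨ φ) ⊎ (v ⊨ ψ)

_⊨?_ : (v : Prop → Bool) (φ : PForm) → Dec (v ⊨ φ)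
v ⊨? atom p   = v p ≟ true
v ⊨? neg φ    = ¬? (v ⊨? φ)
v ⊨? disj φ ψ = (v ⊨? φ) ⊎-dec (v ⊨? ψ)

Entails : {S : Set} → (Prop → S → Bool) → PForm → PForm → Set
Entails V ψ χ = ∀ t → flip V t ⊨ ψ → flip V t ⊨ χ

-- Conjunction is ¬(¬φ ∨ ¬ψ), so constructively only ¬¬ of each conjunct comes back.
module BigConjunction {F : Set} (sat : F → Set) (bigConj : List F → F)
  (sat-bigConj-[] : sat (bigConj []))
  (sat-bigConj-∷ : ∀ φ φs → sat (bigConj (φ ∷ φs)) ≡ (¬ (¬ sat φ ⊎ ¬ sat (bigConj φs))))
  where

  intro : ∀ n (f : Fin n → F) → (∀ i → sat (f i)) → sat (bigConj (finList n f))
  intro zero    f h = sat-bigConj-[]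
  intro (suc n) f h = subst id (sym (sat-bigConj-∷ _ _))
    [ (λ ¬head → ¬head (h Fin.zero)) , (λ ¬tail → ¬tail (intro n (f ∘ Fin.suc) (h ∘ Fin.suc))) ]

  elim : ∀ n (f : Fin n → F) → sat (bigConj (finList n f)) → ∀ i → ¬ ¬ sat (f i)
  elim (suc n) f h Fin.zero    ¬head = subst id (sat-bigConj-∷ _ _) h (inj₁ ¬head)
  elim (suc n) f h (Fin.suc i) ¬fi   =
    subst id (sat-bigConj-∷ _ _) h (inj₂ (λ tail → elim n (f ∘ Fin.suc) tail i ¬fi))

module BigConjKh (M : LTS) (s : LTS.S M) =
  BigConjunction (λ φ → satKh M φ s) bigConjKh (toSum (LTS.V M 0 s ≟ true)) (λ _ _ → refl)

module BigConjA (M : AModel) (s : AModel.S M) =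
  BigConjunction (λ φ → satA M φ s) bigConjA (toSum (AModel.V M 0 s ≟ true)) (λ _ _ → refl)

module _ (M : LTS) where
  open LTS M

  satKh-toKh : ∀ φ t → satKh M (toKh φ) t ≡ flip V t ⊨ φ
  satKh-toKh (atom p)   t = refl
  satKh-toKh (neg φ)    t = cong ¬_ (satKh-toKh φ t)
  satKh-toKh (disj φ ψ) t = cong₂ _⊎_ (satKh-toKh φ t) (satKh-toKh ψ t)

  satKh⇒⊨ : ∀ φ t → satKh M (toKh φ) t → flip V t ⊨ φ
  satKh⇒⊨ φ t = subst id (satKh-toKh φ t)

  ⊨⇒satKh : ∀ φ t → flip V t ⊨ φ → satKh M (toKh φ) t
  ⊨⇒satKh φ t = subst id (sym (satKh-toKh φ t))

  Entails⇒Kh : ∀ {ψ χ} s → Entails V ψ χ → satKh M (Kh (toKh ψ) (toKh χ)) s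
  Entails⇒Kh {ψ} {χ} s ψ⇒χ = [] , (λ _ _ → tt) , λ { t .t ψt refl →
    ⊨⇒satKh χ t (ψ⇒χ t (satKh⇒⊨ ψ t ψt)) }

  TransitionFree : Set
  TransitionFree = ∀ a t u → ¬ R a t u

  Kh⇒Entails : TransitionFree → ∀ {ψ χ} s → satKh M (Kh (toKh ψ) (toKh χ)) s → Entails V ψ χ
  Kh⇒Entails free {ψ} {χ} s ([] , _ , ψ⇒χ) t ψt =
    satKh⇒⊨ χ t (ψ⇒χ t t (⊨⇒satKh ψ t ψt) refl)
  Kh⇒Entails free {ψ} s ((a ∷ π) , executable , _) t ψt
    with executable t (⊨⇒satKh ψ t ψt)
  ... | (u , tRu) , _ = ⊥-elim (free a t u tRu)

module _ (M : AModel) where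
  open AModel M

  satA-toA : ∀ φ t → satA M (toA φ) t ≡ flip V t ⊨ φ
  satA-toA (atom p)   t = refl
  satA-toA (neg φ)    t = cong ¬_ (satA-toA φ t)
  satA-toA (disj φ ψ) t = cong₂ _⊎_ (satA-toA φ t) (satA-toA ψ t)

  satA⇒⊨ : ∀ φ t → satA M (toA φ) t → flip V t ⊨ φ
  satA⇒⊨ φ t = subst id (satA-toA φ t)

  ⊨⇒satA : ∀ φ t → flip V t ⊨ φ → satA M (toA φ) t
  ⊨⇒satA φ t = subst id (sym (satA-toA φ t))

  satA-E-∧¬⇔¬Entails : ∀ ψ χ s → satA M (E (conjA (toA ψ) (neg (toA χ)))) s ⇔ (¬ Entails V ψ χ)
  satA-E-∧¬⇔¬Entails ψ χ s = mk⇔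
    (λ witness ψ⇒χ → witness λ t ψ∧¬χ →
      ψ∧¬χ (inj₁ λ ψt → ψ∧¬χ (inj₂ λ ¬χt → ¬χt (⊨⇒satA χ t (ψ⇒χ t (satA⇒⊨ ψ t ψt))))))
    (λ ¬ψ⇒χ noWitness → ¬ψ⇒χ λ t ψt → decidable-stable (flip V t ⊨? χ) λ ¬χt →
      noWitness t [ (λ ¬ψt → ¬ψt (⊨⇒satA ψ t ψt)) , (λ ¬¬χt → ¬¬χt (¬χt ∘ satA⇒⊨ χ t)) ])

forget : LTS → AModel
forget M = record { S = LTS.S M ; s₀ = LTS.s₀ M ; V = LTS.V M }

discrete : AModel → LTS
discrete M = record { S = AModel.S M ; s₀ = AModel.s₀ M ; R = λ _ _ _ → ⊥ ; V = AModel.V M }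

lemma3 : (n : ℕ) (ψ χ : Fin n → PForm) →
    (SatisfiableKh (phiMinus n ψ χ) → SatisfiableA (thetaMinus n ψ χ)) ×
    (SatisfiableA (thetaMinus n ψ χ) → SatisfiableKh (phiMinus n ψ χ))
lemma3 n ψ χ = φ⁻⇒θ⁻ , θ⁻⇒φ⁻
  where
  φ⁻⇒θ⁻ : SatisfiableKh (phiMinus n ψ χ) → SatisfiableA (thetaMinus n ψ χ)
  φ⁻⇒θ⁻ (M , s , φ⁻) = forget M , s , BigConjA.intro (forget M) s n _ λ i →
    Equivalence.from (satA-E-∧¬⇔¬Entails (forget M) (ψ i) (χ i) s) λ ψ⇒χ →
      BigConjKh.elim M s n _ φ⁻ i λ ¬Kh → ¬Kh (Entails⇒Kh M s ψ⇒χ)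

  θ⁻⇒φ⁻ : SatisfiableA (thetaMinus n ψ χ) → SatisfiableKh (phiMinus n ψ χ)
  θ⁻⇒φ⁻ (M , s , θ⁻) = discrete M , s , BigConjKh.intro (discrete M) s n _ λ i Kh →
    BigConjA.elim M s n _ θ⁻ i λ E∧¬ →
      Equivalence.to (satA-E-∧¬⇔¬Entails M (ψ i) (χ i) s) E∧¬ (Kh⇒Entails (discrete M) (λ _ _ _ ()) s Kh)
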